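{- For every integer $d\ge 0$, $\mathcal{P}_{F_{d+1}}=\mathcal{S}_d$.
   Context: The Boolean rank of a $(0,1)$-matrix is the minimal number of all-ones combinatorial rectangles needed to cover its $1$-entries. $\mathcal{S}_d$ is the set of all $(0,1)$-matrices of Boolean rank at most $d$. $F_{k}$ is the set of all $(0,1)$-matrices of Boolean rank exactly $k$ that have no repeated rows and no repeated columns. For a collection $F$ of $(0,1)$-matrices, $\mathcal{P}_F$ is the set of all $(0,1)$-matrices that do not contain as a submatrix (a subset of rows times a subset of columns) any row and/or column permutation of a member of $F$. -}

module Defs where

open import Data.Nat using (ℕ; suc; _≤_)
open import Data.Fin using (Fin)
open import Data.Bool using (Bool; true)
open import Data.Product using (Σ; ∃; ∃-syntax; _×_)
open import Relation.Nullary using (¬_)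
open import Relation.Binary.PropositionalEquality using (_≡_)
open import Function.Bundles using (_⇔_)
open import Function.Definitions using (Injective)

Mat : ℕ → ℕ → Set
Mat m n = Fin m → Fin n → Bool

-- A family of k combinatorial rectangles R t × C t (row set R t, column set C t)
-- covers exactly the 1-entries of M: M i j = 1 iff (i , j) lies in some rectangle.
-- (Each rectangle is then automatically all-ones in M.)
Covers : ∀ {m n} (M : Mat m n) (k : ℕ) → (Fin k → Fin m → Bool) → (Fin k → Fin n → Bool) → Set
Covers M k R C = ∀ i j → (M i j ≡ true) ⇔ (∃[ t ] (R t i ≡ true × C t j ≡ true))

CoverableBy : ∀ {m n} → Mat m n → ℕ → Set
CoverableBy {m} {n} M k = Σ (Fin k → Fin m → Bool) λ R → Σ (Fin k → Fin n → Bool) λ C → Covers M k R C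

BoolRank : ∀ {m n} → Mat m n → ℕ → Set
BoolRank M r = CoverableBy M r × (∀ k → CoverableBy M k → r ≤ k)

InS : ℕ → ∀ {m n} → Mat m n → Set
InS d M = ∃[ r ] (BoolRank M r × r ≤ d)

DistinctRows : ∀ {p q} → Mat p q → Set
DistinctRows {p} {q} A = ∀ (i i' : Fin p) → (∀ j → A i j ≡ A i' j) → i ≡ i'

DistinctCols : ∀ {p q} → Mat p q → Set
DistinctCols {p} {q} A = ∀ (j j' : Fin q) → (∀ i → A i j ≡ A i j') → j ≡ j'

InF : ℕ → ∀ {p q} → Mat p q → Set
InF k A = BoolRank A k × DistinctRows A × DistinctCols A

-- M contains (a row and/or column permutation of) A as a submatrix:
-- there are injective row and column selections f, g with M (f i) (g j) = A i j.
Contains : ∀ {m n p q} → Mat m n → Mat p q → Set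
Contains {m} {n} {p} {q} M A =
  Σ (Fin p → Fin m) λ f → Σ (Fin q → Fin n) λ g →
    Injective _≡_ _≡_ f × Injective _≡_ _≡_ g × (∀ i j → M (f i) (g j) ≡ A i j)

InP : (∀ {p q} → Mat p q → Set) → ∀ {m n} → Mat m n → Set
InP F M = ∀ p q (A : Mat p q) → F A → ¬ Contains M A

-- A matrix not coverable by d rectangles contains a critical submatrix: one still not
-- coverable by d rectangles, but coverable by d once any single row or column is deleted
-- (delete rows and columns for as long as uncoverability survives).  A critical matrix has
-- Boolean rank exactly d + 1, since one extra rectangle covers a deleted row, and no repeated
-- rows or columns, since deleting one copy of a repeated row does not change coverability;
-- so it lies in F_{d+1}.  Conversely, submatrices of a matrix of Boolean rank at most d have
-- Boolean rank at most d.  Constructively, all of this rests on coverability by k rectangles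
-- being decidable by exhaustive search over the finitely many families of rectangles.
module Submission where

open import Defs
open import Level using (0ℓ)
open import Data.Nat using (ℕ; zero; suc; _≤_; _<_; _≤′_; ≤′-refl; ≤′-step; z≤n; s≤s; _≤?_)
open import Data.Nat.Properties using (≤⇒≤′; ≰⇒>; ≤-pred; ≤-trans; <-irrefl)
open import Data.Fin using (Fin; zero; suc; punchIn; punchOut; _≟_)
open import Data.Fin.Properties using (punchIn-injective; punchIn-punchOut; any?; all?; ¬∀⟶∃¬)
open import Data.Bool using (Bool; true; false)
open import Data.Bool.Properties using () renaming (_≟_ to _≟ᵇ_)
open import Data.Product using (Σ; ∃; ∃-syntax; ∃₂; _×_; _,_)
open import Data.Vec.Functional using (Vector; []; _∷_; head; tail; removeAt; transpose)
open import Data.Vec.Functional.Relation.Binary.Pointwise using (Pointwise)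
open import Data.Empty using (⊥-elim)
open import Relation.Nullary using (¬_; Dec; yes; no; contradiction)
open import Relation.Nullary.Decidable using (map′; _×-dec_; _→-dec_)
open import Relation.Unary using (Pred; Decidable)
open import Relation.Binary using (Rel; Reflexive)
open import Relation.Binary.Definitions using (_Respects_)
open import Relation.Binary.PropositionalEquality using (_≡_; refl; sym; trans; cong)
open import Function.Base using (const)
open import Function.Bundles using (_⇔_; mk⇔; Equivalence)

open Equivalence using (to; from)

Searchable : (A : Set) → Rel A 0ℓ → Set₁
Searchable A _≈_ = ∀ {P : Pred A 0ℓ} → P Respects _≈_ → Decidable P → Dec (∃ P)

Bool-searchable : Searchable Bool _≡_
Bool-searchable _ P? with P? true | P? false
... | yes p | _     = yes (true , p)
... | no _  | yes p = yes (false , p)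
... | no ¬t | no ¬f = no λ { (true , p) → ¬t p ; (false , p) → ¬f p }

Vector-searchable : ∀ {A : Set} {_≈_ : Rel A 0ℓ} → Reflexive _≈_ → Searchable A _≈_ →
                    ∀ n → Searchable (Vector A n) (Pointwise _≈_)
Vector-searchable ≈-refl search zero {P} resp P? =
  map′ (λ p → [] , p) (λ (xs , p) → resp (λ ()) p) (P? [])
Vector-searchable {A} {_≈_} ≈-refl search (suc n) {P} resp P? =
  map′ (λ (x , xs , p) → x ∷ xs , p)
       (λ (xs , p) → head xs , tail xs , resp (λ { zero → ≈-refl ; (suc i) → ≈-refl }) p)
       (search Q-resp Q?)
  where
    Q : Pred A 0ℓ
    Q x = ∃ λ xs → P (x ∷ xs)
    Q-resp : Q Respects _≈_
    Q-resp x≈y (xs , p) = xs , resp (λ { zero → x≈y ; (suc i) → ≈-refl }) p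
    Q? : Decidable Q
    Q? x = Vector-searchable ≈-refl search n
             (λ xs≈ys → resp (λ { zero → ≈-refl ; (suc i) → xs≈ys i }))
             (λ xs → P? (x ∷ xs))

Mat-searchable : ∀ m n → Searchable (Mat m n) (Pointwise (Pointwise _≡_))
Mat-searchable m n = Vector-searchable (λ _ → refl) (Vector-searchable refl Bool-searchable n) m

_⇔-dec_ : ∀ {A B : Set} → Dec A → Dec B → Dec (A ⇔ B)
a? ⇔-dec b? = map′ (λ (f , g) → mk⇔ f g) (λ e → to e , from e) ((a? →-dec b?) ×-dec (b? →-dec a?))

covers? : ∀ {m n} (M : Mat m n) k R C → Dec (Covers M k R C)
covers? M k R C = all? λ i → all? λ j →
  (M i j ≟ᵇ true) ⇔-dec any? (λ t → (R t i ≟ᵇ true) ×-dec (C t j ≟ᵇ true))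

covers-resp : ∀ {m n} {M : Mat m n} {k R R' C C'} →
              Pointwise (Pointwise _≡_) R R' → Pointwise (Pointwise _≡_) C C' →
              Covers M k R C → Covers M k R' C'
covers-resp R≈R' C≈C' cv i j = mk⇔
  (λ x → let (t , a , b) = to (cv i j) x in t , trans (sym (R≈R' t i)) a , trans (sym (C≈C' t j)) b)
  (λ (t , a , b) → from (cv i j) (t , trans (R≈R' t i) a , trans (C≈C' t j) b))

coverableBy? : ∀ {m n} (M : Mat m n) k → Dec (CoverableBy M k)
coverableBy? {m} {n} M k =
  Mat-searchable k m (λ R≈R' (C , cv) → C , covers-resp R≈R' (λ _ _ → refl) cv)
    λ R → Mat-searchable k n (λ C≈C' → covers-resp (λ _ _ → refl) C≈C') (covers? M k R)

coverableBy-suc : ∀ {m n} {M : Mat m n} {k} → CoverableBy M k → CoverableBy M (suc k)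
coverableBy-suc (R , C , cv) = const false ∷ R , const false ∷ C , λ i j → mk⇔
  (λ x → let (t , a , b) = to (cv i j) x in suc t , a , b)
  (λ { (zero , () , _) ; (suc t , a , b) → from (cv i j) (t , a , b) })

coverableBy-mono : ∀ {m n} {M : Mat m n} {k k'} → k ≤ k' → CoverableBy M k → CoverableBy M k'
coverableBy-mono k≤k' = go (≤⇒≤′ k≤k')
  where
    go : ∀ {m n} {M : Mat m n} {k k'} → k ≤′ k' → CoverableBy M k → CoverableBy M k'
    go ≤′-refl        c = c
    go (≤′-step k≤k') c = coverableBy-suc (go k≤k' c)

coverableBy-reindex : ∀ {m n p q} {M : Mat m n} {N : Mat p q} (f : Fin p → Fin m) (g : Fin q → Fin n) →
                      (∀ i j → N i j ≡ M (f i) (g j)) → ∀ {k} → CoverableBy M k → CoverableBy N k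
coverableBy-reindex f g N≡M (R , C , cv) = (λ t i → R t (f i)) , (λ t j → C t (g j)) , λ i j → mk⇔
  (λ x → to (cv (f i) (g j)) (trans (sym (N≡M i j)) x))
  (λ y → trans (N≡M i j) (from (cv (f i) (g j)) y))

coverableBy-transpose : ∀ {m n} {M : Mat m n} {k} → CoverableBy M k → CoverableBy (transpose M) k
coverableBy-transpose (R , C , cv) = C , R , λ j i → mk⇔
  (λ x → let (t , a , b) = to (cv i j) x in t , b , a)
  (λ (t , b , a) → from (cv i j) (t , a , b))

coverableBy-empty-rows : ∀ {n} (M : Mat 0 n) k → CoverableBy M k
coverableBy-empty-rows M k = (λ _ ()) , (λ _ _ → false) , λ ()

coverableBy-empty-cols : ∀ {m} (M : Mat m 0) k → CoverableBy M k
coverableBy-empty-cols M k = (λ _ _ → false) , (λ _ ()) , λ _ ()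

-- The extra rectangle is the first row times its support.
coverableBy-tail : ∀ {p q} {M : Mat (suc p) q} {k} → CoverableBy (tail M) k → CoverableBy M (suc k)
coverableBy-tail {p} {q} {M} {k} (R , C , cv) = R' , C' , cover
  where
    R' : Fin (suc k) → Fin (suc p) → Bool
    R' = (true ∷ const false) ∷ (λ t → false ∷ R t)
    C' : Fin (suc k) → Fin q → Bool
    C' = M zero ∷ C
    cover : Covers M (suc k) R' C'
    cover zero j = mk⇔ (λ x → zero , refl , x)
      (λ { (zero , _ , x) → x ; (suc t , () , _) })
    cover (suc i) j = mk⇔
      (λ x → let (t , a , b) = to (cv i j) x in suc t , a , b)
      (λ { (zero , () , _) ; (suc t , a , b) → from (cv i j) (t , a , b) })

coverableBy-removeAt-duplicate : ∀ {p q} {N : Mat (suc p) q} {i i'} → ¬ i ≡ i' →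
                                 (∀ j → N i j ≡ N i' j) →
                                 ∀ {k} → CoverableBy (removeAt N i) k → CoverableBy N k
coverableBy-removeAt-duplicate {p} {N = N} {i} {i'} i≢i' same =
  coverableBy-reindex redirect (λ j → j) same-row
  where
    redirect : Fin (suc p) → Fin p
    redirect r with i ≟ r
    ... | yes _   = punchOut i≢i'
    ... | no i≢r = punchOut i≢r
    same-row : ∀ r j → N r j ≡ N (punchIn i (redirect r)) j
    same-row r j with i ≟ r
    ... | yes refl = trans (same j) (cong (λ z → N z j) (sym (punchIn-punchOut i≢i')))
    ... | no i≢r  = cong (λ z → N z j) (sym (punchIn-punchOut i≢r))

least-witness : ∀ {P : Pred ℕ 0ℓ} → Decidable P → ∀ {d} → P d →
                ∃[ r ] (P r × r ≤ d × (∀ k → P k → r ≤ k))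
least-witness {P} P? {d} Pd with P? zero
... | yes P0 = zero , P0 , z≤n , λ _ _ → z≤n
least-witness {P} P? {zero}  Pd | no ¬P0 = contradiction Pd ¬P0
least-witness {P} P? {suc d} Pd | no ¬P0 =
  let (r , Pr , r≤d , least) = least-witness (λ k → P? (suc k)) Pd
  in suc r , Pr , s≤s r≤d , λ { zero P0 → contradiction P0 ¬P0 ; (suc k) Pk → s≤s (least k Pk) }

coverableBy⇒InS : ∀ {m n} {M : Mat m n} {d} → CoverableBy M d → InS d M
coverableBy⇒InS {M = M} c =
  let (r , cr , r≤d , least) = least-witness (coverableBy? M) c in r , (cr , least) , r≤d

¬coverableBy⇒< : ∀ {m n} {M : Mat m n} {d k} → ¬ CoverableBy M d → CoverableBy M k → d < k
¬coverableBy⇒< {d = d} {k} ¬c c with suc d ≤? k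
... | yes d<k = d<k
... | no  d≮k = contradiction (coverableBy-mono (≤-pred (≰⇒> d≮k)) c) ¬c

removeCol : ∀ {p q} → Mat p (suc q) → Fin (suc q) → Mat p q
removeCol N j = transpose (removeAt (transpose N) j)

record Critical (d : ℕ) {p q} (N : Mat (suc p) (suc q)) : Set where
  field
    uncoverable          : ¬ CoverableBy N d
    removeAt-coverable  : ∀ i → CoverableBy (removeAt N i) d
    removeCol-coverable : ∀ j → CoverableBy (removeCol N j) d

distinctRows-of-row-critical : ∀ {p q} {N : Mat (suc p) q} {d} → ¬ CoverableBy N d →
                               (∀ i → CoverableBy (removeAt N i) d) → DistinctRows N
distinctRows-of-row-critical ¬c removable i i' same with i ≟ i'
... | yes i≡i' = i≡i'
... | no  i≢i' = contradiction (coverableBy-removeAt-duplicate i≢i' same (removable i)) ¬c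

critical⇒InF : ∀ {d p q} {N : Mat (suc p) (suc q)} → Critical d N → InF (suc d) N
critical⇒InF crit =
  (coverableBy-tail (removeAt-coverable zero) , λ k → ¬coverableBy⇒< uncoverable) ,
  distinctRows-of-row-critical uncoverable removeAt-coverable ,
  distinctRows-of-row-critical (λ c → uncoverable (coverableBy-transpose c))
    (λ j → coverableBy-transpose (removeCol-coverable j))
  where open Critical crit

contains-refl : ∀ {m n} {M : Mat m n} → Contains M M
contains-refl = (λ i → i) , (λ j → j) , (λ eq → eq) , (λ eq → eq) , λ _ _ → refl

contains-trans : ∀ {m n p q r s} {M : Mat m n} {N : Mat p q} {A : Mat r s} →
                 Contains M N → Contains N A → Contains M A
contains-trans (f , g , f-inj , g-inj , M≡N) (f' , g' , f'-inj , g'-inj , N≡A) =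
  (λ i → f (f' i)) , (λ j → g (g' j)) , (λ eq → f'-inj (f-inj eq)) , (λ eq → g'-inj (g-inj eq)) ,
  λ i j → trans (M≡N (f' i) (g' j)) (N≡A i j)

contains-removeAt : ∀ {p q} (N : Mat (suc p) q) i → Contains N (removeAt N i)
contains-removeAt N i = punchIn i , (λ j → j) , punchIn-injective i _ _ , (λ eq → eq) , λ _ _ → refl

contains-removeCol : ∀ {p q} (N : Mat p (suc q)) j → Contains N (removeCol N j)
contains-removeCol N j = (λ i → i) , punchIn j , (λ eq → eq) , punchIn-injective j _ _ , λ _ _ → refl

critical-submatrix : ∀ d p q (N : Mat p q) → ¬ CoverableBy N d →
                     ∃₂ λ p' q' → Σ (Mat (suc p') (suc q')) λ N' → Contains N N' × Critical d N'
critical-submatrix d zero    q       N ¬c = contradiction (coverableBy-empty-rows N d) ¬c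
critical-submatrix d (suc p) zero    N ¬c = contradiction (coverableBy-empty-cols N d) ¬c
critical-submatrix d (suc p) (suc q) N ¬c
  with all? (λ i → coverableBy? (removeAt N i) d) | all? (λ j → coverableBy? (removeCol N j) d)
... | yes rows | yes cols = p , q , N , contains-refl , record
  { uncoverable = ¬c ; removeAt-coverable = rows ; removeCol-coverable = cols }
... | no ¬rows | _ =
  let (i , ¬ci) = ¬∀⟶∃¬ _ _ (λ i → coverableBy? (removeAt N i) d) ¬rows
      (p' , q' , N' , N⊇N' , crit) = critical-submatrix d p (suc q) (removeAt N i) ¬ci
  in p' , q' , N' , contains-trans {M = N} (contains-removeAt N i) N⊇N' , crit
... | yes _ | no ¬cols =
  let (j , ¬cj) = ¬∀⟶∃¬ _ _ (λ j → coverableBy? (removeCol N j) d) ¬cols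
      (p' , q' , N' , N⊇N' , crit) = critical-submatrix d (suc p) q (removeCol N j) ¬cj
  in p' , q' , N' , contains-trans {M = N} (contains-removeCol N j) N⊇N' , crit

claim8 : ∀ (d : ℕ) (m n : ℕ) (M : Mat m n) → InP (InF (suc d)) M ⇔ InS d M
claim8 d m n M = mk⇔ forward backward
  where
    forward : InP (InF (suc d)) M → InS d M
    forward avoids with coverableBy? M d
    ... | yes c  = coverableBy⇒InS c
    ... | no  ¬c =
      let (p , q , N , M⊇N , crit) = critical-submatrix d m n M ¬c
      in ⊥-elim (avoids _ _ N (critical⇒InF crit) M⊇N)
    backward : InS d M → InP (InF (suc d)) M
    backward (r , (cr , _) , r≤d) p q A ((_ , minimal) , _) (f , g , _ , _ , M≡A) =
      <-irrefl refl (≤-trans (minimal r (coverableBy-reindex f g (λ i j → sym (M≡A i j)) cr)) r≤d)
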